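{- Let $q\ge5$ be an integer and let $a_n,b_n,d_n,e_n$ be the numbers of vertices of types $A,B,D,E$, respectively, on level $n$ of the Pascal pyramid $\mathcal{PP}_{4,q}$ in $\mathbf{H}^2\times\mathbf{R}$ (defined in the context). Then for every $n\ge1$ $$d_n=-a_n+\frac{1}{q-4}\,b_n+(n-1),\qquad e_n=a_n-(n-1).$$
   Context: Fix an integer $q\ge5$ and the regular tiling $\{4,q\}$ of the hyperbolic plane by congruent squares, $q$ squares meeting at each vertex; let $d$ be the edge length. Hyperbolic Pascal triangle $\mathcal{HPT}$ (a subgraph of the tiling), built row by row. Row $0$ is a single base vertex $V_0$. The leftmost and rightmost vertices of each row $j\ge1$ are called wingers; every other vertex of row $j\ge 2$ has type $A$ or $B$. From each vertex of row $j$ one draws, in order from left to right, its descending edges (tiling edges going away from $V_0$): $2$ from $V_0$ and from each winger, $q-2$ from each vertex of type $A$, $q-1$ from each vertex of type $B$. For two consecutive vertices of row $j$, the rightmost descending edge of the left one and the leftmost descending edge of the right one end at a common vertex of row $j+1$, which is of type $A$; the two outermost descending edges of row $j$ end at the two wingers of row $j+1$; all remaining descending edges end at distinct vertices of row $j+1$, which are of type $B$. (Thus row $n$ consists of the vertices at graph distance $n$ from $V_0$; a non-winger has type $A$ iff it has two neighbours in the previous row, type $B$ iff it has one.) Pascal pyramid $\mathcal{PP}_{4,q}$. Place $\mathcal{HPT}$ in the plane $\mathbf{H}^2\times\{0\}$ of $\mathbf{H}^2\times\mathbf{R}$ and copy it to the planes $\mathbf{H}^2\times\{kd\}$, $k=1,2,\dots$,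 with corresponding vertices on the same fibre (part of the square-prism tiling of $\mathbf{H}^2\times\mathbf{R}$). Vertices are pairs $(v,k)$, $v$ a vertex of $\mathcal{HPT}$, $k\in\mathbb{Z}_{\ge0}$; edges join $(v,k)$–$(w,k)$ for each edge $vw$ of $\mathcal{HPT}$, and $(v,k)$–$(v,k+1)$. Level $n$ is the set of $(v,k)$ with $v$ in row $r$ and $r+k=n$ (edge-distance $n$ from $(V_0,0)$). Vertex types on level $n\ge1$: type $1$: $(V_0,k)$, $k\ge1$, and $(w,0)$, $w$ a winger; type $A$ (resp. $B$): $(v,0)$ with $v$ of type $A$ (resp. $B$); type $C$: $(w,k)$, $w$ a winger, $k\ge1$; type $D$ (resp. $E$): $(v,k)$, $k\ge1$, $v$ of type $A$ (resp. $B$). -}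

module Defs where

open import Data.Nat using (ℕ; zero; suc; _∸_)
open import Data.Nat.Properties using (_≟_)
open import Data.List using (List; []; _∷_; _++_; [_]; replicate; map; concatMap; upTo; filter; length)
open import Data.Product using (_×_; _,_)

-- Vertex kinds in the hyperbolic Pascal triangle HPT:
-- base vertex V0, wingers W, and types A, B.
data HV : Set where
  V0 W A B : HV

-- number of descending edges in the tiling {4,q}
desc : ℕ → HV → ℕ
desc q V0 = 2
desc q W  = 2
desc q A  = q ∸ 2
desc q B  = q ∸ 1

-- descending edges of a vertex other than its leftmost and rightmost
-- end at distinct new vertices of type B
mids : ℕ → HV → List HV
mids q v = replicate (desc q v ∸ 2) B

-- the interior of the next row, left to right: the middle B's of each vertex,
-- separated by the shared type-A vertex of two consecutive vertices
inner : ℕ → List HV → List HV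
inner q [] = []
inner q (v ∷ []) = mids q v
inner q (v ∷ w ∷ vs) = mids q v ++ (A ∷ inner q (w ∷ vs))

-- next row: the two outermost descending edges give the wingers
next : ℕ → List HV → List HV
next q r = W ∷ (inner q r ++ [ W ])

row : ℕ → ℕ → List HV
row q zero = [ V0 ]
row q (suc j) = next q (row q j)

-- level n of the Pascal pyramid PP_{4,q}: pairs (v , k) with v in row r, r + k = n
level : ℕ → ℕ → List (HV × ℕ)
level q n = concatMap (λ k → map (λ v → (v , k)) (row q (n ∸ k))) (upTo (suc n))

data PT : Set where
  base t1 tA tB tC tD tE : PT

classify : HV × ℕ → PT
classify (V0 , zero)  = base
classify (V0 , suc k) = t1
classify (W  , zero)  = t1
classify (A  , zero)  = tA
classify (B  , zero)  = tB
classify (W  , suc k) = tC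
classify (A  , suc k) = tD
classify (B  , suc k) = tE

code : PT → ℕ
code base = 0
code t1 = 1
code tA = 2
code tB = 3
code tC = 4
code tD = 5
code tE = 6

count : ℕ → PT → ℕ → ℕ
count q t n = length (filter (λ x → code (classify x) ≟ code t) (level q n))

-- Level n of the pyramid consists of the rows n − k of the hyperbolic Pascal triangle lifted to
-- height k, so a_n and b_n are the numbers α_n, β_n of type-A and type-B vertices in row n, while
-- d_n = Σ_{j<n} α_j and e_n = Σ_{j<n} β_j. Row j + 1 has one type-A vertex between any two
-- consecutive vertices of row j and one type-B vertex for each middle descending edge, whence
-- α_{j+2} = 1 + α_{j+1} + β_{j+1} and β_{j+1} = (q − 4) α_j + (q − 3) β_j. Summing these recurrences
-- gives e_n + (n − 1) = a_n and (q − 4)(d_n + a_n) = b_n + (q − 4)(n − 1); dividing by q − 4 in ℚ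
-- yields the claim.

module Submission where

open import Defs

module Counting where

  open import Data.Bool.Base using (true; false; if_then_else_)
  open import Data.List.Base
    using (List; []; _∷_; _++_; [_]; map; concatMap; applyUpTo; upTo; filter; length; replicate)
  open import Data.List.Properties using (map-++; map-∘; map-cong; map-applyUpTo; length-++; length-replicate)
  open import Data.Nat.Base using (ℕ; zero; suc; _+_; _*_; _∸_)
  open import Data.Nat.ListAction using (sum)
  open import Data.Nat.ListAction.Properties using (sum-++)
  open import Data.Nat.Properties using (_≟_; +-identityʳ; +-comm; *-zeroʳ)
  open import Data.Nat.Tactic.RingSolver using (solve-∀)
  open import Data.Product.Base using (_×_; _,_)
  open import Function.Base using (_∘_; const)
  open import Level using (Level)
  open import Relation.Binary.PropositionalEquality
    using (_≡_; refl; sym; trans; cong; cong₂; module ≡-Reasoning)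
  open import Relation.Nullary.Decidable.Core using (does)
  open import Relation.Unary using (Pred; Decidable)

  private
    variable
      a p : Level
      X Y : Set a

  indicator : {P : Pred X p} → Decidable P → X → ℕ
  indicator P? x = if does (P? x) then 1 else 0

  length-filter≡sum-indicator : {P : Pred X p} (P? : Decidable P) (xs : List X) →
    length (filter P? xs) ≡ sum (map (indicator P?) xs)
  length-filter≡sum-indicator P? [] = refl
  length-filter≡sum-indicator P? (x ∷ xs) with does (P? x)
  ... | true  = cong suc (length-filter≡sum-indicator P? xs)
  ... | false = length-filter≡sum-indicator P? xs

  sum-map-++ : (f : X → ℕ) (xs ys : List X) → sum (map f (xs ++ ys)) ≡ sum (map f xs) + sum (map f ys)
  sum-map-++ f xs ys = trans (cong sum (map-++ f xs ys)) (sum-++ (map f xs) (map f ys))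

  sum-map-concatMap : (f : Y → ℕ) (g : X → List Y) (xs : List X) →
    sum (map f (concatMap g xs)) ≡ sum (map (sum ∘ map f ∘ g) xs)
  sum-map-concatMap f g [] = refl
  sum-map-concatMap f g (x ∷ xs) =
    trans (sum-map-++ f (g x) (concatMap g xs)) (cong (sum (map f (g x)) +_) (sum-map-concatMap f g xs))

  sum-map-const-0 : (xs : List X) → sum (map (const 0) xs) ≡ 0
  sum-map-const-0 [] = refl
  sum-map-const-0 (x ∷ xs) = sum-map-const-0 xs

  prefixSum : (ℕ → ℕ) → ℕ → ℕ
  prefixSum f zero = 0
  prefixSum f (suc n) = f n + prefixSum f n

  prefixSum-zero : {f : ℕ → ℕ} (n : ℕ) → (∀ j → f j ≡ 0) → prefixSum f n ≡ 0
  prefixSum-zero zero f≡0 = refl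
  prefixSum-zero (suc n) f≡0 = cong₂ _+_ (f≡0 n) (prefixSum-zero n f≡0)

  sum-applyUpTo-reverse : (F : ℕ → ℕ → ℕ) (f : ℕ → ℕ) → (∀ k r → F (suc k) r ≡ f r) →
    ∀ n → sum (applyUpTo (λ k → F (suc k) (n ∸ suc k)) n) ≡ prefixSum f n
  sum-applyUpTo-reverse F f F≡f zero = refl
  sum-applyUpTo-reverse F f F≡f (suc n) =
    cong₂ _+_ (F≡f 0 n) (sum-applyUpTo-reverse (F ∘ suc) f (F≡f ∘ suc) n)

  isA isB : HV → ℕ
  isA A = 1
  isA _ = 0
  isB B = 1
  isB _ = 0

  numA numB : List HV → ℕ
  numA vs = sum (map isA vs)
  numB vs = sum (map isB vs)

  excess : ℕ → List HV → ℕ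
  excess q vs = sum (map (λ v → desc q v ∸ 2) vs)

  numA-replicate-B : ∀ k → numA (replicate k B) ≡ 0
  numA-replicate-B zero = refl
  numA-replicate-B (suc k) = numA-replicate-B k

  numB-replicate-B : ∀ k → numB (replicate k B) ≡ k
  numB-replicate-B zero = refl
  numB-replicate-B (suc k) = cong suc (numB-replicate-B k)

  numA-inner : ∀ q v vs → numA (inner q (v ∷ vs)) ≡ length vs
  numA-inner q v [] = numA-replicate-B (desc q v ∸ 2)
  numA-inner q v (w ∷ vs) =
    trans (sum-map-++ isA (mids q v) _) (cong₂ _+_ (numA-replicate-B (desc q v ∸ 2)) (cong suc (numA-inner q w vs)))

  numB-inner : ∀ q vs → numB (inner q vs) ≡ excess q vs
  numB-inner q [] = refl
  numB-inner q (v ∷ []) = trans (numB-replicate-B (desc q v ∸ 2)) (sym (+-identityʳ _))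
  numB-inner q (v ∷ w ∷ vs) =
    trans (sum-map-++ isB (mids q v) _) (cong₂ _+_ (numB-replicate-B (desc q v ∸ 2)) (numB-inner q (w ∷ vs)))

  length-inner : ∀ q v vs → length (inner q (v ∷ vs)) ≡ length vs + excess q (v ∷ vs)
  length-inner q v [] = trans (length-replicate (desc q v ∸ 2)) (sym (+-identityʳ _))
  length-inner q v (w ∷ vs) = begin
    length (mids q v ++ A ∷ inner q (w ∷ vs))          ≡⟨ length-++ (mids q v) ⟩
    length (mids q v) + suc (length (inner q (w ∷ vs))) ≡⟨ cong₂ (λ x y → x + suc y) (length-replicate k) (length-inner q w vs) ⟩
    k + suc (length vs + excess q (w ∷ vs))           ≡⟨ rearrange k (length vs) (excess q (w ∷ vs)) ⟩
    suc (length vs) + (k + excess q (w ∷ vs))         ∎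
    where
      open ≡-Reasoning
      k = desc q v ∸ 2
      rearrange : ∀ k l e → k + suc (l + e) ≡ suc l + (k + e)
      rearrange = solve-∀

  length-inner≡numA+numB : ∀ q vs → length (inner q vs) ≡ numA (inner q vs) + numB (inner q vs)
  length-inner≡numA+numB q [] = refl
  length-inner≡numA+numB q (v ∷ vs) =
    trans (length-inner q v vs) (sym (cong₂ _+_ (numA-inner q v vs) (numB-inner q (v ∷ vs))))

  sum-map-next : ∀ q (f : HV → ℕ) → f W ≡ 0 → ∀ vs → sum (map f (next q vs)) ≡ sum (map f (inner q vs))
  sum-map-next q f fW≡0 vs = begin
    f W + sum (map f (inner q vs ++ [ W ]))  ≡⟨ cong₂ _+_ fW≡0 (sum-map-++ f (inner q vs) [ W ]) ⟩
    sum (map f (inner q vs)) + (f W + 0)     ≡⟨ cong (λ x → sum (map f (inner q vs)) + (x + 0)) fW≡0 ⟩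
    sum (map f (inner q vs)) + 0             ≡⟨ +-identityʳ _ ⟩
    sum (map f (inner q vs))                 ∎
    where open ≡-Reasoning

  numA-row-2+ : ∀ q j → numA (row q (2 + j)) ≡ suc (numA (row q (suc j)) + numB (row q (suc j)))
  numA-row-2+ q j = begin
    numA (row q (2 + j))                                       ≡⟨ sum-map-next q isA refl (row q (suc j)) ⟩
    numA (inner q (W ∷ (inner q (row q j) ++ [ W ])))          ≡⟨ numA-inner q W (inner q (row q j) ++ [ W ]) ⟩
    length (inner q (row q j) ++ [ W ])                        ≡⟨ length-++ (inner q (row q j)) ⟩
    length (inner q (row q j)) + 1                             ≡⟨ +-comm _ 1 ⟩
    suc (length (inner q (row q j)))                           ≡⟨ cong suc (length-inner≡numA+numB q (row q j)) ⟩
    suc (numA (inner q (row q j)) + numB (inner q (row q j)))  ≡⟨ cong suc (sym (cong₂ _+_ (sum-map-next q isA refl (row q j))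
                                                                                           (sum-map-next q isB refl (row q j)))) ⟩
    suc (numA (row q (suc j)) + numB (row q (suc j)))          ∎
    where open ≡-Reasoning

  -- Writing q as `4 + c` makes `desc q A ∸ 2 = c` and `desc q B ∸ 2 = 1 + c` hold by computation.
  excess-linear : ∀ c vs → excess (4 + c) vs ≡ c * numA vs + suc c * numB vs
  excess-linear c [] = sym (cong₂ _+_ (*-zeroʳ c) (*-zeroʳ (suc c)))
  excess-linear c (V0 ∷ vs) = excess-linear c vs
  excess-linear c (W ∷ vs) = excess-linear c vs
  excess-linear c (A ∷ vs) = trans (cong (c +_) (excess-linear c vs)) (add-A c (numA vs) (numB vs))
    where
      add-A : ∀ c x y → c + (c * x + suc c * y) ≡ c * suc x + suc c * y
      add-A = solve-∀
  excess-linear c (B ∷ vs) = trans (cong (suc c +_) (excess-linear c vs)) (add-B c (numA vs) (numB vs))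
    where
      add-B : ∀ c x y → suc c + (c * x + suc c * y) ≡ c * x + suc c * suc y
      add-B = solve-∀

  numB-row-suc : ∀ c j → numB (row (4 + c) (suc j)) ≡ c * numA (row (4 + c) j) + suc c * numB (row (4 + c) j)
  numB-row-suc c j = trans (sum-map-next (4 + c) isB refl (row (4 + c) j))
                           (trans (numB-inner (4 + c) (row (4 + c) j)) (excess-linear c (row (4 + c) j)))

  numA-row≡prefixSum-numB : ∀ q m → prefixSum (numB ∘ row q) (suc m) + m ≡ numA (row q (suc m))
  numA-row≡prefixSum-numB q zero = refl
  numA-row≡prefixSum-numB q (suc m) = begin
    (y + s) + suc m       ≡⟨ rearrange y s m ⟩
    suc ((s + m) + y)     ≡⟨ cong (λ z → suc (z + y)) (numA-row≡prefixSum-numB q m) ⟩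
    suc (x + y)           ≡⟨ sym (numA-row-2+ q m) ⟩
    numA (row q (2 + m))  ∎
    where
      open ≡-Reasoning
      x = numA (row q (suc m))
      y = numB (row q (suc m))
      s = prefixSum (numB ∘ row q) (suc m)
      rearrange : ∀ y s m → (y + s) + suc m ≡ suc ((s + m) + y)
      rearrange = solve-∀

  numB-row≡prefixSum-numA : ∀ c m → let q = 4 + c in
    c * (prefixSum (numA ∘ row q) (suc m) + numA (row q (suc m))) ≡ numB (row q (suc m)) + c * m
  numB-row≡prefixSum-numA c zero = refl
  numB-row≡prefixSum-numA c (suc m) = begin
    c * ((x + s) + numA (row q (2 + m)))  ≡⟨ cong (λ z → c * ((x + s) + z)) (numA-row-2+ q m) ⟩
    c * ((x + s) + suc (x + y))           ≡⟨ split c x y s ⟩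
    c * (s + x) + (c * x + c * y + c)     ≡⟨ cong (_+ (c * x + c * y + c)) (numB-row≡prefixSum-numA c m) ⟩
    (y + c * m) + (c * x + c * y + c)     ≡⟨ collect c x y m ⟩
    (c * x + suc c * y) + c * suc m       ≡⟨ cong (_+ c * suc m) (sym (numB-row-suc c (suc m))) ⟩
    numB (row q (2 + m)) + c * suc m      ∎
    where
      open ≡-Reasoning
      q = 4 + c
      x = numA (row q (suc m))
      y = numB (row q (suc m))
      s = prefixSum (numA ∘ row q) (suc m)
      split : ∀ c x y s → c * ((x + s) + suc (x + y)) ≡ c * (s + x) + (c * x + c * y + c)
      split = solve-∀
      collect : ∀ c x y m → (y + c * m) + (c * x + c * y + c) ≡ (c * x + suc c * y) + c * suc m
      collect = solve-∀

  ofType : PT → HV × ℕ → ℕ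
  ofType t = indicator (λ x → code (classify x) ≟ code t)

  count-by-layers : ∀ q t (g₀ g : HV → ℕ) →
    (∀ v → ofType t (v , 0) ≡ g₀ v) → (∀ k v → ofType t (v , suc k) ≡ g v) →
    ∀ n → count q t n ≡ sum (map g₀ (row q n)) + prefixSum (λ r → sum (map g (row q r))) n
  count-by-layers q t g₀ g ground upper n = begin
    count q t n                                                            ≡⟨ length-filter≡sum-indicator _ (level q n) ⟩
    sum (map (ofType t) (level q n))                                       ≡⟨ sum-map-concatMap (ofType t) (λ k → map (_, k) (row q (n ∸ k))) (upTo (suc n)) ⟩
    layer 0 n + sum (map (λ k → layer k (n ∸ k)) (applyUpTo suc n))        ≡⟨ cong (layer 0 n +_) (cong sum (map-applyUpTo suc _ n)) ⟩
    layer 0 n + sum (applyUpTo (λ k → layer (suc k) (n ∸ suc k)) n)        ≡⟨ cong₂ _+_ (layer≡ ground n)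
                                                                                (sum-applyUpTo-reverse layer _ (layer≡ ∘ upper) n) ⟩
    sum (map g₀ (row q n)) + prefixSum (λ r → sum (map g (row q r))) n     ∎
    where
      open ≡-Reasoning
      layer : ℕ → ℕ → ℕ
      layer k r = sum (map (ofType t) (map (_, k) (row q r)))
      layer≡ : ∀ {k} {h : HV → ℕ} → (∀ v → ofType t (v , k) ≡ h v) → ∀ r → layer k r ≡ sum (map h (row q r))
      layer≡ eq r = cong sum (trans (sym (map-∘ (row q r))) (map-cong eq (row q r)))

  count-ground : ∀ q t (g : HV → ℕ) →
    (∀ v → ofType t (v , 0) ≡ g v) → (∀ k v → ofType t (v , suc k) ≡ 0) →
    ∀ n → count q t n ≡ sum (map g (row q n))
  count-ground q t g ground upper n =
    trans (count-by-layers q t g (const 0) ground upper n)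
          (trans (cong (sum (map g (row q n)) +_) (prefixSum-zero n (sum-map-const-0 ∘ row q))) (+-identityʳ _))

  count-upper : ∀ q t (g : HV → ℕ) →
    (∀ v → ofType t (v , 0) ≡ 0) → (∀ k v → ofType t (v , suc k) ≡ g v) →
    ∀ n → count q t n ≡ prefixSum (λ r → sum (map g (row q r))) n
  count-upper q t g ground upper n =
    trans (count-by-layers q t (const 0) g ground upper n) (cong (_+ prefixSum _ n) (sum-map-const-0 (row q n)))

  count-tA : ∀ q n → count q tA n ≡ numA (row q n)
  count-tA q = count-ground q tA isA (λ { V0 → refl ; W → refl ; A → refl ; B → refl })
                                     (λ { _ V0 → refl ; _ W → refl ; _ A → refl ; _ B → refl })

  count-tB : ∀ q n → count q tB n ≡ numB (row q n)
  count-tB q = count-ground q tB isB (λ { V0 → refl ; W → refl ; A → refl ; B → refl })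
                                     (λ { _ V0 → refl ; _ W → refl ; _ A → refl ; _ B → refl })

  count-tD : ∀ q n → count q tD n ≡ prefixSum (numA ∘ row q) n
  count-tD q = count-upper q tD isA (λ { V0 → refl ; W → refl ; A → refl ; B → refl })
                                    (λ { _ V0 → refl ; _ W → refl ; _ A → refl ; _ B → refl })

  count-tE : ∀ q n → count q tE n ≡ prefixSum (numB ∘ row q) n
  count-tE q = count-upper q tE isB (λ { V0 → refl ; W → refl ; A → refl ; B → refl })
                                    (λ { _ V0 → refl ; _ W → refl ; _ A → refl ; _ B → refl })

  count-tE+m≡count-tA : ∀ q m → count q tE (suc m) + m ≡ count q tA (suc m)
  count-tE+m≡count-tA q m rewrite count-tE q (suc m) | count-tA q (suc m) = numA-row≡prefixSum-numB q m

  c*[count-tD+count-tA]≡count-tB+c*m : ∀ c m → let q = 4 + c in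
    c * (count q tD (suc m) + count q tA (suc m)) ≡ count q tB (suc m) + c * m
  c*[count-tD+count-tA]≡count-tB+c*m c m
    rewrite count-tD (4 + c) (suc m) | count-tA (4 + c) (suc m) | count-tB (4 + c) (suc m)
    = numB-row≡prefixSum-numA c m

open Counting
open import Data.Integer.Base as ℤ using (+_)
open import Data.Integer.Properties using (pos-+; pos-*)
open import Data.Integer.Tactic.RingSolver using (solve-∀)
import Data.Nat.Base as ℕ
open import Data.Nat.Base using (ℕ; suc; _≤_; _∸_; s≤s; NonZero)
open import Data.Product.Base using (_×_; _,_)
open import Data.Rational.Base using (_/_; _+_; _-_; -_; toℚᵘ)
open import Data.Rational.Properties using (toℚᵘ-injective; toℚᵘ-fromℚᵘ; toℚᵘ-homo-+; toℚᵘ-homo‿-)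
open import Data.Rational.Unnormalised.Base as ᵘ using (mkℚᵘ; *≡*) renaming (_≃_ to _≃ᵘ_)
open import Data.Rational.Unnormalised.Properties using (≃-refl; ≃-sym; ≃-trans; +-cong; -‿cong; module ≃-Reasoning)
open import Relation.Binary.PropositionalEquality using (_≡_; refl; sym; cong; module ≡-Reasoning)

toℚᵘ-/ : ∀ i d → toℚᵘ (i / suc d) ≃ᵘ mkℚᵘ i d
toℚᵘ-/ i d = toℚᵘ-fromℚᵘ (mkℚᵘ i d)

-- `p ≃ᵘ q` unfolds to `↥ p * ↧ q ≡ ↥ q * ↧ p`; the ring identities below are stated in exactly
-- that unfolded form, which is where the factors `+ 1` come from.
cross-difference : ∀ i j → mkℚᵘ i 0 ≃ᵘ mkℚᵘ (i ℤ.+ j) 0 ᵘ.- mkℚᵘ j 0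
cross-difference i j = *≡* (identity i j)
  where
    identity : ∀ i j → i ℤ.* + 1 ≡ ((i ℤ.+ j) ℤ.* + 1 ℤ.+ (ℤ.- j) ℤ.* + 1) ℤ.* + 1
    identity = solve-∀

cross-quotient : ∀ i j k l p → let c = + suc p in c ℤ.* (i ℤ.+ j) ≡ k ℤ.+ c ℤ.* l →
  mkℚᵘ i 0 ≃ᵘ (ᵘ.- mkℚᵘ j 0 ᵘ.+ mkℚᵘ k p) ᵘ.+ mkℚᵘ l 0
cross-quotient i j k l p h = *≡* (begin
  i ℤ.* ((+ 1 ℤ.* c) ℤ.* + 1)                                                    ≡⟨ expand i j c ⟩
  c ℤ.* (i ℤ.+ j) ℤ.- j ℤ.* c                                                    ≡⟨ cong (ℤ._- j ℤ.* c) h ⟩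
  (k ℤ.+ c ℤ.* l) ℤ.- j ℤ.* c                                                    ≡⟨ contract j k l c ⟩
  ((((ℤ.- j) ℤ.* c ℤ.+ k ℤ.* + 1) ℤ.* + 1) ℤ.+ l ℤ.* (+ 1 ℤ.* c)) ℤ.* + 1        ∎)
  where
    open ≡-Reasoning
    c = + suc p
    expand : ∀ i j c → i ℤ.* ((+ 1 ℤ.* c) ℤ.* + 1) ≡ c ℤ.* (i ℤ.+ j) ℤ.- j ℤ.* c
    expand = solve-∀
    contract : ∀ j k l c → (k ℤ.+ c ℤ.* l) ℤ.- j ℤ.* c ≡ ((((ℤ.- j) ℤ.* c ℤ.+ k ℤ.* + 1) ℤ.* + 1) ℤ.+ l ℤ.* (+ 1 ℤ.* c)) ℤ.* + 1
    contract = solve-∀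

toℚᵘ-homo-- : ∀ p q → toℚᵘ (p - q) ≃ᵘ toℚᵘ p ᵘ.- toℚᵘ q
toℚᵘ-homo-- p q = ≃-trans (toℚᵘ-homo-+ p (- q)) (+-cong (≃-refl {toℚᵘ p}) (toℚᵘ-homo‿- q))

m+n≡o⇒m≡o-n : ∀ m n {o} → m ℕ.+ n ≡ o → + m / 1 ≡ + o / 1 - + n / 1
m+n≡o⇒m≡o-n m n refl = toℚᵘ-injective (begin
  toℚᵘ (+ m / 1)                             ≈⟨ toℚᵘ-/ (+ m) 0 ⟩
  mkℚᵘ (+ m) 0                               ≈⟨ cross-difference (+ m) (+ n) ⟩
  mkℚᵘ (+ m ℤ.+ + n) 0 ᵘ.- mkℚᵘ (+ n) 0      ≡⟨ cong (λ i → mkℚᵘ i 0 ᵘ.- mkℚᵘ (+ n) 0) (sym (pos-+ m n)) ⟩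
  mkℚᵘ (+ (m ℕ.+ n)) 0 ᵘ.- mkℚᵘ (+ n) 0      ≈⟨ ≃-sym (+-cong (toℚᵘ-/ (+ (m ℕ.+ n)) 0) (-‿cong (toℚᵘ-/ (+ n) 0))) ⟩
  toℚᵘ (+ (m ℕ.+ n) / 1) ᵘ.- toℚᵘ (+ n / 1)  ≈⟨ ≃-sym (toℚᵘ-homo-- (+ (m ℕ.+ n) / 1) (+ n / 1)) ⟩
  toℚᵘ (+ (m ℕ.+ n) / 1 - + n / 1)           ∎)
  where open ≃-Reasoning

c[d+a]≡b+cm⇒d≡-a+b/c+m : ∀ c .{{_ : NonZero c}} d a b m → c ℕ.* (d ℕ.+ a) ≡ b ℕ.+ c ℕ.* m →
  + d / 1 ≡ - (+ a / 1) + + b / c + + m / 1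
c[d+a]≡b+cm⇒d≡-a+b/c+m c@(suc p) d a b m h = toℚᵘ-injective (begin
  toℚᵘ (+ d / 1)                                              ≈⟨ toℚᵘ-/ (+ d) 0 ⟩
  mkℚᵘ (+ d) 0                                                ≈⟨ cross-quotient (+ d) (+ a) (+ b) (+ m) p hℤ ⟩
  (ᵘ.- mkℚᵘ (+ a) 0 ᵘ.+ mkℚᵘ (+ b) p) ᵘ.+ mkℚᵘ (+ m) 0        ≈⟨ ≃-sym (+-cong (+-cong neg-a (toℚᵘ-/ (+ b) p)) (toℚᵘ-/ (+ m) 0)) ⟩
  (toℚᵘ (- (+ a / 1)) ᵘ.+ toℚᵘ (+ b / c)) ᵘ.+ toℚᵘ (+ m / 1)  ≈⟨ ≃-sym (+-cong (toℚᵘ-homo-+ (- (+ a / 1)) (+ b / c)) ≃-refl) ⟩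
  toℚᵘ (- (+ a / 1) + + b / c) ᵘ.+ toℚᵘ (+ m / 1)             ≈⟨ ≃-sym (toℚᵘ-homo-+ (- (+ a / 1) + + b / c) (+ m / 1)) ⟩
  toℚᵘ (- (+ a / 1) + + b / c + + m / 1)                      ∎)
  where
    open ≃-Reasoning
    neg-a : toℚᵘ (- (+ a / 1)) ≃ᵘ ᵘ.- mkℚᵘ (+ a) 0
    neg-a = ≃-trans (toℚᵘ-homo‿- (+ a / 1)) (-‿cong (toℚᵘ-/ (+ a) 0))
    hℤ : + c ℤ.* (+ d ℤ.+ + a) ≡ + b ℤ.+ + c ℤ.* + m
    hℤ = ≡.begin
      + c ℤ.* (+ d ℤ.+ + a)  ≡.≡⟨ cong (+ c ℤ.*_) (sym (pos-+ d a)) ⟩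
      + c ℤ.* + (d ℕ.+ a)    ≡.≡⟨ sym (pos-* c (d ℕ.+ a)) ⟩
      + (c ℕ.* (d ℕ.+ a))    ≡.≡⟨ cong +_ h ⟩
      + (b ℕ.+ c ℕ.* m)      ≡.≡⟨ pos-+ b (c ℕ.* m) ⟩
      + b ℤ.+ + (c ℕ.* m)    ≡.≡⟨ cong (ℤ._+_ (+ b)) (pos-* c m) ⟩
      + b ℤ.+ + c ℤ.* + m    ≡.∎
      where module ≡ = ≡-Reasoning

lemma3p1 : (q : ℕ) → 5 ≤ q → .{{_ : NonZero (q ∸ 4)}} → (n : ℕ) → 1 ≤ n →
    ((+ count q tD n / 1) ≡ (- (+ count q tA n / 1)) + (+ count q tB n / (q ∸ 4)) + (+ (n ∸ 1) / 1))
    × ((+ count q tE n / 1) ≡ (+ count q tA n / 1) - (+ (n ∸ 1) / 1))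
lemma3p1 _ (s≤s (s≤s (s≤s (s≤s {n = c} _)))) _ (s≤s {n = m} _) =
  c[d+a]≡b+cm⇒d≡-a+b/c+m c (count q tD n) (count q tA n) (count q tB n) m (c*[count-tD+count-tA]≡count-tB+c*m c m) ,
  m+n≡o⇒m≡o-n (count q tE n) m (count-tE+m≡count-tA q m)
  where
    q = 4 ℕ.+ c
    n = suc m
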